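{- Fix a moding and consider atoms $p(s;t)$ and $p(s';t')$ such that $s\ddot{=} s'$ is WNSTO. If $s\ddot{=} s'$ is not unifiable, then $p(s;t)\doteq p(s';t')$ is WNSTO. If $\theta$ is an mgu of $s\ddot{=} s'$ and $(t\ddot{=} t')\theta$ is WNSTO, then $p(s;t)\doteq p(s';t')$ is WNSTO.
   Context: A moding assigns to each argument position of each predicate either $+$ (input) or $-$ (output); $p(s;t)$ denotes an atom whose sequence of terms in input positions is $s$ and in output positions is $t$. For sequences $s=s_1,\ldots,s_n$ and $t=t_1,\ldots,t_n$, $s\ddot{=} t$ denotes the equation set $\{s_1\doteq t_1,\ldots,s_n\doteq t_n\}$. MMA (Martelli–Montanari algorithm) operates on a finite equation set by nondeterministically choosing an equation and applying: (1) $f(s_1,\ldots,s_n)\doteq f(t_1,\ldots,t_n)$ → replace by $s_i\doteq t_i$; (2) $f(\ldots)\doteq g(\ldots)$, $f\ne g$ → fail; (3) $X\doteq X$ → delete; (4) $t\doteq X$, $t$ not a variable → replace by $X\doteq t$; (5) $X\doteq t$, $X\notin Var(t)$, $X$ occurring elsewhere → apply $\{X/t\}$ to all other equations; (6) $X\doteq t$, $X\in Var(t)$, $X\ne t$ → fail. An equation set is WNSTO if some run of MMA on it does not perform action (6); an equation $e$ is WNSTO if $\{e\}$ is. -}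

module Defs where

open import Data.List using (List; []; _∷_; _++_; map; length; zip)
open import Data.List.Relation.Unary.All using (All)
open import Data.List.Relation.Unary.Any using (Any)
open import Data.Product using (Σ; ∃; _×_; _,_; proj₁; proj₂)
open import Data.Sum using (_⊎_)
open import Data.Bool using (if_then_else_)
open import Relation.Nullary using (¬_; does)
open import Relation.Binary.PropositionalEquality using (_≡_; _≢_)
open import Relation.Binary.Definitions using (DecidableEquality)
open import Relation.Binary.Construct.Closure.ReflexiveTransitive using (Star)

-- Modes of argument positions: + (input) and - (output).
data Mode : Set where
  plus minus : Mode

module Syntax (F V : Set) (_≟_ : DecidableEquality V) where

  data Term : Set where
    var : V → Term
    fun : F → List Term → Term

  record Eqn : Set where
    constructor _≐_
    field
      lhs rhs : Term
  open Eqn public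

  EqSet : Set
  EqSet = List Eqn

  _≐̈_ : List Term → List Term → EqSet
  [] ≐̈ _ = []
  (_ ∷ _) ≐̈ [] = []
  (s ∷ ss) ≐̈ (t ∷ ts) = (s ≐ t) ∷ (ss ≐̈ ts)

  mutual
    data _∈V_ (x : V) : Term → Set where
      here : x ∈V var x
      arg  : ∀ {f ts} → x ∈Vs ts → x ∈V fun f ts

    data _∈Vs_ (x : V) : List Term → Set where
      hd : ∀ {t ts} → x ∈V t → x ∈Vs (t ∷ ts)
      tl : ∀ {t ts} → x ∈Vs ts → x ∈Vs (t ∷ ts)

  _∈E_ : V → EqSet → Set
  x ∈E E = Any (λ e → x ∈V lhs e ⊎ x ∈V rhs e) E

  Subst : Set
  Subst = V → Term

  mutual
    _⟨_⟩ : Term → Subst → Term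
    var x ⟨ σ ⟩ = σ x
    fun f ts ⟨ σ ⟩ = fun f (ts ⟨ σ ⟩s)

    _⟨_⟩s : List Term → Subst → List Term
    [] ⟨ σ ⟩s = []
    (t ∷ ts) ⟨ σ ⟩s = (t ⟨ σ ⟩) ∷ (ts ⟨ σ ⟩s)

  _⟨_⟩e : Eqn → Subst → Eqn
  (s ≐ t) ⟨ σ ⟩e = (s ⟨ σ ⟩) ≐ (t ⟨ σ ⟩)

  _⟨_⟩E : EqSet → Subst → EqSet
  E ⟨ σ ⟩E = map (λ e → e ⟨ σ ⟩e) E

  [_/_] : V → Term → Subst
  [ x / t ] y = if does (y ≟ x) then t else var y

  data IsVar : Term → Set where
    isVar : ∀ x → IsVar (var x)

  -- MMA actions (1),(3),(4),(5): an equation is chosen anywhere in the set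
  data _⟶_ : EqSet → EqSet → Set where
    act1 : ∀ L R f ss ts → length ss ≡ length ts →
           (L ++ (fun f ss ≐ fun f ts) ∷ R) ⟶ (L ++ (ss ≐̈ ts) ++ R)
    act3 : ∀ L R x →
           (L ++ (var x ≐ var x) ∷ R) ⟶ (L ++ R)
    act4 : ∀ L R t x → ¬ IsVar t →
           (L ++ (t ≐ var x) ∷ R) ⟶ (L ++ (var x ≐ t) ∷ R)
    act5 : ∀ L R x t → ¬ (x ∈V t) → x ∈E (L ++ R) →
           (L ++ (var x ≐ t) ∷ R) ⟶
           ((L ⟨ [ x / t ] ⟩E) ++ (var x ≐ t) ∷ (R ⟨ [ x / t ] ⟩E))

  -- action (2) applies (and yields failure); symbols are identified
  -- together with their arity
  Act2 : EqSet → Set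
  Act2 E = Σ (List Eqn) λ L → Σ (List Eqn) λ R → Σ F λ f → Σ F λ g →
           Σ (List Term) λ ss → Σ (List Term) λ ts →
           (E ≡ L ++ (fun f ss ≐ fun g ts) ∷ R) × (f ≢ g ⊎ length ss ≢ length ts)

  Act6 : EqSet → Set
  Act6 E = Σ (List Eqn) λ L → Σ (List Eqn) λ R → Σ V λ x → Σ Term λ t →
           (E ≡ L ++ (var x ≐ t) ∷ R) × (x ∈V t) × (t ≢ var x)

  Halted : EqSet → Set
  Halted E = (∀ E' → ¬ (E ⟶ E')) × ¬ Act2 E × ¬ Act6 E

  -- some complete run of MMA never performs action (6): it either ends by
  -- performing action (2) or halts with no action applicable
  WNSTO : EqSet → Set
  WNSTO E = ∃ λ E' → Star _⟶_ E E' × (Act2 E' ⊎ Halted E')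

  WNSTOₑ : Eqn → Set
  WNSTOₑ e = WNSTO (e ∷ [])

  Unifier : Subst → EqSet → Set
  Unifier θ E = All (λ e → (lhs e ⟨ θ ⟩) ≡ (rhs e ⟨ θ ⟩)) E

  Unifiable : EqSet → Set
  Unifiable E = ∃ λ θ → Unifier θ E

  MGU : Subst → EqSet → Set
  MGU θ E = Unifier θ E ×
            (∀ η → Unifier η E → ∃ λ δ → ∀ x → η x ≡ (θ x ⟨ δ ⟩))

  Moding : Set
  Moding = F → List Mode

  ins : List Mode → List Term → List Term
  ins [] _ = []
  ins (_ ∷ _) [] = []
  ins (plus ∷ ms) (a ∷ as) = a ∷ ins ms as
  ins (minus ∷ ms) (a ∷ as) = ins ms as

  outs : List Mode → List Term → List Term
  outs [] _ = []
  outs (_ ∷ _) [] = []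
  outs (plus ∷ ms) (a ∷ as) = outs ms as
  outs (minus ∷ ms) (a ∷ as) = a ∷ outs ms as

  WellModed : Moding → F → List Term → Set
  WellModed M p as = length as ≡ length (M p)

{-# OPTIONS --safe #-}
-- Action (1) turns p(s;t) ≐ p(s';t') into s ≐̈ s' ∪ t ≐̈ t', and MMA runs are
-- insensitive to the order of the equations, so MMA may first be run on
-- s ≐̈ s' while t ≐̈ t' is merely instantiated along the way.  If that run
-- clashes, so does the whole run.  Otherwise it halts in a solved form S whose
-- substitution σ unifies s ≐̈ s' (impossible in the non-unifiable case), and
-- eliminating the variables of S turns the rest into (t ≐̈ t')σ.  As σ and θ are
-- both most general unifiers, (t ≐̈ t')σ is a renaming of (t ≐̈ t')θ, and
-- renamings transport MMA runs; since the variables of (t ≐̈ t')σ avoid the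
-- domain of S, the run transported from (t ≐̈ t')θ can be carried out next to S,
-- and if it halts in a solved form H, then H together with S instantiated by H
-- is again solved.
module Submission where

open import Defs
open import Data.Empty using (⊥-elim)
open import Data.Nat using (suc)
open import Data.Nat.Properties using (suc-injective) renaming (_≟_ to _≟ℕ_)
open import Data.List using (List; []; _∷_; _++_; [_]; map; length)
open import Data.List.Properties using (map-++; ++-assoc; ++-identityʳ; ∷-injective)
open import Data.List.Relation.Unary.All using ([]; _∷_)
import Data.List.Relation.Unary.All.Properties as All
open import Data.List.Relation.Unary.Any using (Any; here; there)
import Data.List.Relation.Unary.Any.Properties as Any
open import Data.List.Membership.Propositional using (find)
open import Data.List.Membership.Propositional.Properties using (∈-∃++)
open import Data.List.Relation.Binary.Permutation.Propositional
  using (_↭_; prep; ↭-refl; ↭-sym; ↭-trans)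
import Data.List.Relation.Binary.Permutation.Propositional.Properties as ↭
open import Data.Product using (∃; ∃₂; _×_; _,_; proj₁; proj₂)
open import Data.Sum using (_⊎_; inj₁; inj₂; [_,_]′)
import Data.Sum as Sum
open import Relation.Nullary using (¬_; Dec; yes; no)
open import Relation.Binary.Definitions using (DecidableEquality)
open import Relation.Binary.Construct.Closure.ReflexiveTransitive using (Star; ε; _◅_; _◅◅_)
open import Relation.Binary.PropositionalEquality
  using (_≡_; _≢_; refl; sym; trans; cong; cong₂; subst; subst₂; module ≡-Reasoning)

module MMA (F V : Set) (_≟_ : DecidableEquality V) where
  open Syntax F V _≟_ public

  _⨾_ : Subst → Subst → Subst
  (σ ⨾ τ) x = σ x ⟨ τ ⟩

  mutual
    ⟨⟩-⨾ : ∀ t σ τ → t ⟨ σ ⟩ ⟨ τ ⟩ ≡ t ⟨ σ ⨾ τ ⟩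
    ⟨⟩-⨾ (var x) σ τ = refl
    ⟨⟩-⨾ (fun f ts) σ τ = cong (fun f) (⟨⟩s-⨾ ts σ τ)

    ⟨⟩s-⨾ : ∀ ts σ τ → ts ⟨ σ ⟩s ⟨ τ ⟩s ≡ ts ⟨ σ ⨾ τ ⟩s
    ⟨⟩s-⨾ [] σ τ = refl
    ⟨⟩s-⨾ (t ∷ ts) σ τ = cong₂ _∷_ (⟨⟩-⨾ t σ τ) (⟨⟩s-⨾ ts σ τ)

  mutual
    ⟨⟩-cong : ∀ t {σ τ} → (∀ x → x ∈V t → σ x ≡ τ x) → t ⟨ σ ⟩ ≡ t ⟨ τ ⟩
    ⟨⟩-cong (var x) σ≗τ = σ≗τ x here
    ⟨⟩-cong (fun f ts) σ≗τ = cong (fun f) (⟨⟩s-cong ts (λ x x∈ → σ≗τ x (arg x∈)))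

    ⟨⟩s-cong : ∀ ts {σ τ} → (∀ x → x ∈Vs ts → σ x ≡ τ x) → ts ⟨ σ ⟩s ≡ ts ⟨ τ ⟩s
    ⟨⟩s-cong [] σ≗τ = refl
    ⟨⟩s-cong (t ∷ ts) σ≗τ =
      cong₂ _∷_ (⟨⟩-cong t (λ x x∈ → σ≗τ x (hd x∈)))
                (⟨⟩s-cong ts (λ x x∈ → σ≗τ x (tl x∈)))

  ⟨⟩-cong′ : ∀ t {σ τ} → (∀ x → σ x ≡ τ x) → t ⟨ σ ⟩ ≡ t ⟨ τ ⟩
  ⟨⟩-cong′ t σ≗τ = ⟨⟩-cong t (λ x _ → σ≗τ x)

  mutual
    ⟨⟩-identity : ∀ t → t ⟨ var ⟩ ≡ t
    ⟨⟩-identity (var x) = refl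
    ⟨⟩-identity (fun f ts) = cong (fun f) (⟨⟩s-identity ts)

    ⟨⟩s-identity : ∀ ts → ts ⟨ var ⟩s ≡ ts
    ⟨⟩s-identity [] = refl
    ⟨⟩s-identity (t ∷ ts) = cong₂ _∷_ (⟨⟩-identity t) (⟨⟩s-identity ts)

  mutual
    ∈V-⟨⟩⁻ : ∀ t σ {y} → y ∈V (t ⟨ σ ⟩) → ∃ λ z → z ∈V t × y ∈V σ z
    ∈V-⟨⟩⁻ (var x) σ y∈ = x , here , y∈
    ∈V-⟨⟩⁻ (fun f ts) σ (arg y∈) with ∈Vs-⟨⟩⁻ ts σ y∈
    ... | z , z∈ , y∈σz = z , arg z∈ , y∈σz

    ∈Vs-⟨⟩⁻ : ∀ ts σ {y} → y ∈Vs (ts ⟨ σ ⟩s) → ∃ λ z → z ∈Vs ts × y ∈V σ z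
    ∈Vs-⟨⟩⁻ (t ∷ ts) σ (hd y∈) with ∈V-⟨⟩⁻ t σ y∈
    ... | z , z∈ , y∈σz = z , hd z∈ , y∈σz
    ∈Vs-⟨⟩⁻ (t ∷ ts) σ (tl y∈) with ∈Vs-⟨⟩⁻ ts σ y∈
    ... | z , z∈ , y∈σz = z , tl z∈ , y∈σz

  mutual
    ∈V-⟨⟩⁺ : ∀ t σ {y z} → z ∈V t → y ∈V σ z → y ∈V (t ⟨ σ ⟩)
    ∈V-⟨⟩⁺ (var x) σ here y∈ = y∈
    ∈V-⟨⟩⁺ (fun f ts) σ (arg z∈) y∈ = arg (∈Vs-⟨⟩⁺ ts σ z∈ y∈)

    ∈Vs-⟨⟩⁺ : ∀ ts σ {y z} → z ∈Vs ts → y ∈V σ z → y ∈Vs (ts ⟨ σ ⟩s)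
    ∈Vs-⟨⟩⁺ (t ∷ ts) σ (hd z∈) y∈ = hd (∈V-⟨⟩⁺ t σ z∈ y∈)
    ∈Vs-⟨⟩⁺ (t ∷ ts) σ (tl z∈) y∈ = tl (∈Vs-⟨⟩⁺ ts σ z∈ y∈)

  fun-injectiveʳ : ∀ {f g ss ts} → fun f ss ≡ fun g ts → ss ≡ ts
  fun-injectiveʳ refl = refl

  var-injective : ∀ {x y} → var x ≡ var y → x ≡ y
  var-injective refl = refl

  mutual
    ⟨⟩-fixed : ∀ t σ {y} → t ⟨ σ ⟩ ≡ t → y ∈V t → σ y ≡ var y
    ⟨⟩-fixed (var x) σ fixed here = fixed
    ⟨⟩-fixed (fun f ts) σ fixed (arg y∈) = ⟨⟩s-fixed ts σ (fun-injectiveʳ fixed) y∈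

    ⟨⟩s-fixed : ∀ ts σ {y} → ts ⟨ σ ⟩s ≡ ts → y ∈Vs ts → σ y ≡ var y
    ⟨⟩s-fixed (t ∷ ts) σ fixed (hd y∈) = ⟨⟩-fixed t σ (proj₁ (∷-injective fixed)) y∈
    ⟨⟩s-fixed (t ∷ ts) σ fixed (tl y∈) = ⟨⟩s-fixed ts σ (proj₂ (∷-injective fixed)) y∈

  length-⟨⟩s : ∀ ts σ → length (ts ⟨ σ ⟩s) ≡ length ts
  length-⟨⟩s [] σ = refl
  length-⟨⟩s (t ∷ ts) σ = cong suc (length-⟨⟩s ts σ)

  mutual
    _∈V?_ : ∀ x t → Dec (x ∈V t)
    x ∈V? var y with x ≟ y
    ... | yes refl = yes here
    ... | no x≢y = no λ { here → x≢y refl }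
    x ∈V? fun f ts with x ∈Vs? ts
    ... | yes x∈ = yes (arg x∈)
    ... | no x∉ = no λ { (arg x∈) → x∉ x∈ }

    _∈Vs?_ : ∀ x ts → Dec (x ∈Vs ts)
    x ∈Vs? [] = no λ ()
    x ∈Vs? (t ∷ ts) with x ∈V? t | x ∈Vs? ts
    ... | yes x∈t | _ = yes (hd x∈t)
    ... | no _ | yes x∈ts = yes (tl x∈ts)
    ... | no x∉t | no x∉ts = no λ { (hd x∈t) → x∉t x∈t ; (tl x∈ts) → x∉ts x∈ts }

  [/]-here : ∀ x t → [ x / t ] x ≡ t
  [/]-here x t with x ≟ x
  ... | yes _ = refl
  ... | no x≢x = ⊥-elim (x≢x refl)

  [/]-there : ∀ x t y → y ≢ x → [ x / t ] y ≡ var y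
  [/]-there x t y y≢x with y ≟ x
  ... | yes y≡x = ⊥-elim (y≢x y≡x)
  ... | no _ = refl

  ∈V-[/]⁻ : ∀ x t z {y} → y ∈V [ x / t ] z → (z ≡ x × y ∈V t) ⊎ (y ≡ z × z ≢ x)
  ∈V-[/]⁻ x t z y∈ with z ≟ x
  ... | yes z≡x = inj₁ (z≡x , y∈)
  ∈V-[/]⁻ x t z here | no z≢x = inj₂ (refl , z≢x)

  ⟨⟩-[/]-∉ : ∀ u x t → ¬ x ∈V u → u ⟨ [ x / t ] ⟩ ≡ u
  ⟨⟩-[/]-∉ u x t x∉u =
    trans (⟨⟩-cong u (λ y y∈ → [/]-there x t y λ { refl → x∉u y∈ })) (⟨⟩-identity u)

  [/]⨾-absorbed : ∀ {η x t} → η x ≡ t ⟨ η ⟩ → ∀ z → ([ x / t ] ⨾ η) z ≡ η z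
  [/]⨾-absorbed {x = x} ηx≡tη z with z ≟ x
  ... | yes refl = sym ηx≡tη
  ... | no _ = refl

  ⟨⟩E-++ : ∀ A B σ → (A ++ B) ⟨ σ ⟩E ≡ A ⟨ σ ⟩E ++ B ⟨ σ ⟩E
  ⟨⟩E-++ A B σ = map-++ _ A B

  ⟨⟩E-⨾ : ∀ E σ τ → E ⟨ σ ⟩E ⟨ τ ⟩E ≡ E ⟨ σ ⨾ τ ⟩E
  ⟨⟩E-⨾ [] σ τ = refl
  ⟨⟩E-⨾ ((l ≐ r) ∷ E) σ τ =
    cong₂ _∷_ (cong₂ _≐_ (⟨⟩-⨾ l σ τ) (⟨⟩-⨾ r σ τ)) (⟨⟩E-⨾ E σ τ)

  ⟨⟩E-cong : ∀ E {σ τ} → (∀ x → x ∈E E → σ x ≡ τ x) → E ⟨ σ ⟩E ≡ E ⟨ τ ⟩E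
  ⟨⟩E-cong [] σ≗τ = refl
  ⟨⟩E-cong ((l ≐ r) ∷ E) σ≗τ = cong₂ _∷_
    (cong₂ _≐_ (⟨⟩-cong l (λ x x∈ → σ≗τ x (here (inj₁ x∈))))
               (⟨⟩-cong r (λ x x∈ → σ≗τ x (here (inj₂ x∈)))))
    (⟨⟩E-cong E (λ x x∈ → σ≗τ x (there x∈)))

  ⟨⟩E-identity : ∀ E → E ⟨ var ⟩E ≡ E
  ⟨⟩E-identity [] = refl
  ⟨⟩E-identity ((l ≐ r) ∷ E) =
    cong₂ _∷_ (cong₂ _≐_ (⟨⟩-identity l) (⟨⟩-identity r)) (⟨⟩E-identity E)

  ⟨⟩E-[/]-∉ : ∀ E x t → ¬ x ∈E E → E ⟨ [ x / t ] ⟩E ≡ E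
  ⟨⟩E-[/]-∉ E x t x∉E =
    trans (⟨⟩E-cong E (λ y y∈ → [/]-there x t y λ { refl → x∉E y∈ })) (⟨⟩E-identity E)

  ≐̈-⟨⟩ : ∀ ss ts σ → (ss ≐̈ ts) ⟨ σ ⟩E ≡ (ss ⟨ σ ⟩s) ≐̈ (ts ⟨ σ ⟩s)
  ≐̈-⟨⟩ [] ts σ = refl
  ≐̈-⟨⟩ (s ∷ ss) [] σ = refl
  ≐̈-⟨⟩ (s ∷ ss) (t ∷ ts) σ = cong (_ ∷_) (≐̈-⟨⟩ ss ts σ)

  _∈E?_ : ∀ x E → Dec (x ∈E E)
  x ∈E? [] = no λ ()
  x ∈E? (e ∷ E) with x ∈V? lhs e | x ∈V? rhs e | x ∈E? E
  ... | yes x∈l | _ | _ = yes (here (inj₁ x∈l))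
  ... | no _ | yes x∈r | _ = yes (here (inj₂ x∈r))
  ... | no _ | no _ | yes x∈E = yes (there x∈E)
  ... | no x∉l | no x∉r | no x∉E =
    no λ { (here (inj₁ x∈l)) → x∉l x∈l
         ; (here (inj₂ x∈r)) → x∉r x∈r
         ; (there x∈E) → x∉E x∈E
         }

  ∈E-⟨⟩⁻ : ∀ E σ {y} → y ∈E (E ⟨ σ ⟩E) → ∃ λ z → z ∈E E × y ∈V σ z
  ∈E-⟨⟩⁻ ((l ≐ r) ∷ E) σ (here (inj₁ y∈)) with ∈V-⟨⟩⁻ l σ y∈
  ... | z , z∈ , y∈σz = z , here (inj₁ z∈) , y∈σz
  ∈E-⟨⟩⁻ ((l ≐ r) ∷ E) σ (here (inj₂ y∈)) with ∈V-⟨⟩⁻ r σ y∈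
  ... | z , z∈ , y∈σz = z , here (inj₂ z∈) , y∈σz
  ∈E-⟨⟩⁻ ((l ≐ r) ∷ E) σ (there y∈) with ∈E-⟨⟩⁻ E σ y∈
  ... | z , z∈ , y∈σz = z , there z∈ , y∈σz

  ∈E-⟨⟩⁺ : ∀ E σ {y z} → z ∈E E → y ∈V σ z → y ∈E (E ⟨ σ ⟩E)
  ∈E-⟨⟩⁺ ((l ≐ r) ∷ E) σ (here (inj₁ z∈)) y∈ = here (inj₁ (∈V-⟨⟩⁺ l σ z∈ y∈))
  ∈E-⟨⟩⁺ ((l ≐ r) ∷ E) σ (here (inj₂ z∈)) y∈ = here (inj₂ (∈V-⟨⟩⁺ r σ z∈ y∈))
  ∈E-⟨⟩⁺ ((l ≐ r) ∷ E) σ (there z∈) y∈ = there (∈E-⟨⟩⁺ E σ z∈ y∈)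

  ∈E-≐̈⁻ : ∀ ss ts {y} → y ∈E (ss ≐̈ ts) → y ∈Vs ss ⊎ y ∈Vs ts
  ∈E-≐̈⁻ (s ∷ ss) (t ∷ ts) (here (inj₁ y∈)) = inj₁ (hd y∈)
  ∈E-≐̈⁻ (s ∷ ss) (t ∷ ts) (here (inj₂ y∈)) = inj₂ (hd y∈)
  ∈E-≐̈⁻ (s ∷ ss) (t ∷ ts) (there y∈) = Sum.map tl tl (∈E-≐̈⁻ ss ts y∈)

  Unifier-⟨⟩⁻ : ∀ E σ η → Unifier η (E ⟨ σ ⟩E) → Unifier (σ ⨾ η) E
  Unifier-⟨⟩⁻ [] σ η [] = []
  Unifier-⟨⟩⁻ ((l ≐ r) ∷ E) σ η (u ∷ us) =
    trans (sym (⟨⟩-⨾ l σ η)) (trans u (⟨⟩-⨾ r σ η)) ∷ Unifier-⟨⟩⁻ E σ η us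

  Unifier-⟨⟩⁺ : ∀ E σ η → Unifier (σ ⨾ η) E → Unifier η (E ⟨ σ ⟩E)
  Unifier-⟨⟩⁺ [] σ η [] = []
  Unifier-⟨⟩⁺ ((l ≐ r) ∷ E) σ η (u ∷ us) =
    trans (⟨⟩-⨾ l σ η) (trans u (sym (⟨⟩-⨾ r σ η))) ∷ Unifier-⟨⟩⁺ E σ η us

  Unifier-cong : ∀ E {σ τ} → (∀ z → σ z ≡ τ z) → Unifier σ E → Unifier τ E
  Unifier-cong [] σ≗τ [] = []
  Unifier-cong ((l ≐ r) ∷ E) σ≗τ (u ∷ us) =
    trans (sym (⟨⟩-cong′ l σ≗τ)) (trans u (⟨⟩-cong′ r σ≗τ)) ∷ Unifier-cong E σ≗τ us

  Unifier-[/]⁺ : ∀ E {η x t} → η x ≡ t ⟨ η ⟩ → Unifier η E → Unifier η (E ⟨ [ x / t ] ⟩E)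
  Unifier-[/]⁺ E {η} {x} {t} ηx≡tη u =
    Unifier-⟨⟩⁺ E [ x / t ] η (Unifier-cong E (λ z → sym ([/]⨾-absorbed ηx≡tη z)) u)

  Unifier-[/]⁻ : ∀ E {η x t} → η x ≡ t ⟨ η ⟩ → Unifier η (E ⟨ [ x / t ] ⟩E) → Unifier η E
  Unifier-[/]⁻ E {η} {x} {t} ηx≡tη u =
    Unifier-cong E ([/]⨾-absorbed ηx≡tη) (Unifier-⟨⟩⁻ E [ x / t ] η u)

  ≐̈-Unifier⁺ : ∀ ss ts {η} → length ss ≡ length ts →
               ss ⟨ η ⟩s ≡ ts ⟨ η ⟩s → Unifier η (ss ≐̈ ts)
  ≐̈-Unifier⁺ [] [] _ _ = []
  ≐̈-Unifier⁺ (s ∷ ss) (t ∷ ts) |ss|≡|ts| eq =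
    proj₁ (∷-injective eq) ∷
    ≐̈-Unifier⁺ ss ts (suc-injective |ss|≡|ts|) (proj₂ (∷-injective eq))

  ≐̈-Unifier⁻ : ∀ ss ts {η} → length ss ≡ length ts →
               Unifier η (ss ≐̈ ts) → ss ⟨ η ⟩s ≡ ts ⟨ η ⟩s
  ≐̈-Unifier⁻ [] [] _ _ = refl
  ≐̈-Unifier⁻ (s ∷ ss) (t ∷ ts) |ss|≡|ts| (u ∷ us) =
    cong₂ _∷_ u (≐̈-Unifier⁻ ss ts (suc-injective |ss|≡|ts|) us)

  Run : EqSet → EqSet → Set
  Run = Star _⟶_

  ⟶-vars : ∀ {E E'} → E ⟶ E' → ∀ {y} → y ∈E E' → y ∈E E
  ⟶-vars (act1 L R f ss ts _) y∈ with Any.++⁻ L y∈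
  ... | inj₁ y∈L = Any.++⁺ˡ y∈L
  ... | inj₂ y∈ with Any.++⁻ (ss ≐̈ ts) y∈
  ... | inj₂ y∈R = Any.++⁺ʳ L (there y∈R)
  ... | inj₁ y∈≐̈ = Any.++⁺ʳ L (here (Sum.map arg arg (∈E-≐̈⁻ ss ts y∈≐̈)))
  ⟶-vars (act3 L R x) y∈ with Any.++⁻ L y∈
  ... | inj₁ y∈L = Any.++⁺ˡ y∈L
  ... | inj₂ y∈R = Any.++⁺ʳ L (there y∈R)
  ⟶-vars (act4 L R t x _) y∈ with Any.++⁻ L y∈
  ... | inj₁ y∈L = Any.++⁺ˡ y∈L
  ... | inj₂ (here y∈e) = Any.++⁺ʳ L (here (Sum.swap y∈e))
  ... | inj₂ (there y∈R) = Any.++⁺ʳ L (there y∈R)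
  ⟶-vars (act5 L R x t _ _) y∈ with Any.++⁻ (L ⟨ [ x / t ] ⟩E) y∈
  ... | inj₂ (here y∈e) = Any.++⁺ʳ L (here y∈e)
  ... | inj₁ y∈L with ∈E-⟨⟩⁻ L [ x / t ] y∈L
  ... | z , z∈L , y∈ with ∈V-[/]⁻ x t z y∈
  ... | inj₁ (_ , y∈t) = Any.++⁺ʳ L (here (inj₂ y∈t))
  ... | inj₂ (refl , _) = Any.++⁺ˡ z∈L
  ⟶-vars (act5 L R x t _ _) y∈ | inj₂ (there y∈R) with ∈E-⟨⟩⁻ R [ x / t ] y∈R
  ... | z , z∈R , y∈ with ∈V-[/]⁻ x t z y∈
  ... | inj₁ (_ , y∈t) = Any.++⁺ʳ L (here (inj₂ y∈t))
  ... | inj₂ (refl , _) = Any.++⁺ʳ L (there z∈R)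

  Run-vars : ∀ {E E'} → Run E E' → ∀ {y} → y ∈E E' → y ∈E E
  Run-vars ε y∈ = y∈
  Run-vars (s ◅ r) y∈ = ⟶-vars s (Run-vars r y∈)

  ⟶-Unifier⁺ : ∀ {E E'} → E ⟶ E' → ∀ {η} → Unifier η E → Unifier η E'
  ⟶-Unifier⁺ (act1 L R f ss ts |ss|≡|ts|) u with All.++⁻ L u
  ... | uL , uₑ ∷ uR =
    All.++⁺ uL (All.++⁺ (≐̈-Unifier⁺ ss ts |ss|≡|ts| (fun-injectiveʳ uₑ)) uR)
  ⟶-Unifier⁺ (act3 L R x) u with All.++⁻ L u
  ... | uL , _ ∷ uR = All.++⁺ uL uR
  ⟶-Unifier⁺ (act4 L R t x _) u with All.++⁻ L u
  ... | uL , uₑ ∷ uR = All.++⁺ uL (sym uₑ ∷ uR)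
  ⟶-Unifier⁺ (act5 L R x t _ _) u with All.++⁻ L u
  ... | uL , uₑ ∷ uR = All.++⁺ (Unifier-[/]⁺ L uₑ uL) (uₑ ∷ Unifier-[/]⁺ R uₑ uR)

  ⟶-Unifier⁻ : ∀ {E E'} → E ⟶ E' → ∀ {η} → Unifier η E' → Unifier η E
  ⟶-Unifier⁻ (act1 L R f ss ts |ss|≡|ts|) u with All.++⁻ L u
  ... | uL , u≐̈R with All.++⁻ (ss ≐̈ ts) u≐̈R
  ... | u≐̈ , uR = All.++⁺ uL (cong (fun f) (≐̈-Unifier⁻ ss ts |ss|≡|ts| u≐̈) ∷ uR)
  ⟶-Unifier⁻ (act3 L R x) u with All.++⁻ L u
  ... | uL , uR = All.++⁺ uL (refl ∷ uR)
  ⟶-Unifier⁻ (act4 L R t x _) u with All.++⁻ L u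
  ... | uL , uₑ ∷ uR = All.++⁺ uL (sym uₑ ∷ uR)
  ⟶-Unifier⁻ (act5 L R x t _ _) u with All.++⁻ (L ⟨ [ x / t ] ⟩E) u
  ... | uL , uₑ ∷ uR = All.++⁺ (Unifier-[/]⁻ L uₑ uL) (uₑ ∷ Unifier-[/]⁻ R uₑ uR)

  Run-Unifier⁺ : ∀ {E E'} → Run E E' → ∀ {η} → Unifier η E → Unifier η E'
  Run-Unifier⁺ ε u = u
  Run-Unifier⁺ (s ◅ r) u = Run-Unifier⁺ r (⟶-Unifier⁺ s u)

  Run-Unifier⁻ : ∀ {E E'} → Run E E' → ∀ {η} → Unifier η E' → Unifier η E
  Run-Unifier⁻ ε u = u
  Run-Unifier⁻ (s ◅ r) u = ⟶-Unifier⁻ s (Run-Unifier⁻ r u)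

  -- Running MMA inside a larger equation set

  record Framed (E E' B : EqSet) : Set where
    field
      ρ          : Subst
      run        : Run (E ++ B) (E' ++ B ⟨ ρ ⟩E)
      ρ-absorbed : ∀ η → Unifier η E' → ∀ z → ρ z ⟨ η ⟩ ≡ η z
      ρ-vars     : ∀ z {y} → y ∈V ρ z → y ≡ z ⊎ y ∈E E
      ρ-∉        : ∀ z → ¬ z ∈E E → ρ z ≡ var z

  framed-var : ∀ {E E' B} → Run (E ++ B) (E' ++ B) → Framed E E' B
  framed-var {E} {E'} {B} r = record
    { ρ = var
    ; run = subst (λ B' → Run (E ++ B) (E' ++ B')) (sym (⟨⟩E-identity B)) r
    ; ρ-absorbed = λ _ _ _ → refl
    ; ρ-vars = λ { _ here → inj₁ refl }
    ; ρ-∉ = λ _ _ → refl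
    }

  ++-assoc-mid : ∀ (L M R B : EqSet) → (L ++ M ++ R) ++ B ≡ L ++ M ++ R ++ B
  ++-assoc-mid L M R B = trans (++-assoc L (M ++ R) B) (cong (L ++_) (++-assoc M R B))

  ⟶-frame : ∀ {E E'} → E ⟶ E' → ∀ B → Framed E E' B
  ⟶-frame (act1 L R f ss ts |ss|≡|ts|) B = framed-var
    (subst₂ _⟶_ (sym (++-assoc-mid L [ _ ] R B)) (sym (++-assoc-mid L (ss ≐̈ ts) R B))
      (act1 L (R ++ B) f ss ts |ss|≡|ts|) ◅ ε)
  ⟶-frame (act3 L R x) B = framed-var
    (subst₂ _⟶_ (sym (++-assoc-mid L [ _ ] R B)) (sym (++-assoc L R B)) (act3 L (R ++ B) x) ◅ ε)
  ⟶-frame (act4 L R t x t≢var) B = framed-var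
    (subst₂ _⟶_ (sym (++-assoc-mid L [ _ ] R B)) (sym (++-assoc-mid L [ _ ] R B))
      (act4 L (R ++ B) t x t≢var) ◅ ε)
  ⟶-frame (act5 L R x t x∉t x∈LR) B = record
    { ρ = [ x / t ]
    ; run = subst₂ _⟶_ (sym (++-assoc-mid L [ _ ] R B)) target (act5 L (R ++ B) x t x∉t x∈LRB) ◅ ε
    ; ρ-absorbed = absorbed
    ; ρ-vars = vars
    ; ρ-∉ = λ z z∉ → [/]-there x t z λ { refl → z∉ (Any.++⁺ʳ L (here (inj₁ here))) }
    }
    where
    e = var x ≐ t
    L' = L ⟨ [ x / t ] ⟩E
    target : L' ++ e ∷ (R ++ B) ⟨ [ x / t ] ⟩E
           ≡ (L' ++ e ∷ R ⟨ [ x / t ] ⟩E) ++ B ⟨ [ x / t ] ⟩E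
    target = trans (cong (λ Z → L' ++ e ∷ Z) (⟨⟩E-++ R B [ x / t ]))
                   (sym (++-assoc-mid L' [ e ] (R ⟨ [ x / t ] ⟩E) _))
    x∈LRB : x ∈E (L ++ R ++ B)
    x∈LRB with Any.++⁻ L x∈LR
    ... | inj₁ x∈L = Any.++⁺ˡ x∈L
    ... | inj₂ x∈R = Any.++⁺ʳ L (Any.++⁺ˡ x∈R)
    absorbed : ∀ η → Unifier η (L' ++ e ∷ R ⟨ [ x / t ] ⟩E) →
               ∀ z → [ x / t ] z ⟨ η ⟩ ≡ η z
    absorbed η u with All.++⁻ L' u
    ... | _ , uₑ ∷ _ = [/]⨾-absorbed uₑ
    vars : ∀ z {y} → y ∈V [ x / t ] z → y ≡ z ⊎ y ∈E (L ++ e ∷ R)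
    vars z y∈ with ∈V-[/]⁻ x t z y∈
    ... | inj₁ (_ , y∈t) = inj₂ (Any.++⁺ʳ L (here (inj₂ y∈t)))
    ... | inj₂ (y≡z , _) = inj₁ y≡z

  Run-frame : ∀ {E E'} → Run E E' → ∀ B → Framed E E' B
  Run-frame ε B = framed-var ε
  Run-frame {E} (s ◅ r) B = record
    { ρ = F₁.ρ ⨾ F₂.ρ
    ; run = F₁.run ◅◅ subst (λ B' → Run _ (_ ++ B')) (⟨⟩E-⨾ B F₁.ρ F₂.ρ) F₂.run
    ; ρ-absorbed = absorbed
    ; ρ-vars = vars
    ; ρ-∉ = λ z z∉ →
        trans (cong (_⟨ F₂.ρ ⟩) (F₁.ρ-∉ z z∉)) (F₂.ρ-∉ z (λ z∈ → z∉ (⟶-vars s z∈)))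
    }
    where
    module F₁ = Framed (⟶-frame s B)
    module F₂ = Framed (Run-frame r (B ⟨ F₁.ρ ⟩E))
    absorbed : ∀ η → Unifier η _ → ∀ z → F₁.ρ z ⟨ F₂.ρ ⟩ ⟨ η ⟩ ≡ η z
    absorbed η u z = begin
      F₁.ρ z ⟨ F₂.ρ ⟩ ⟨ η ⟩  ≡⟨ ⟨⟩-⨾ (F₁.ρ z) F₂.ρ η ⟩
      F₁.ρ z ⟨ F₂.ρ ⨾ η ⟩    ≡⟨ ⟨⟩-cong′ (F₁.ρ z) (F₂.ρ-absorbed η u) ⟩
      F₁.ρ z ⟨ η ⟩           ≡⟨ F₁.ρ-absorbed η (Run-Unifier⁻ r u) z ⟩
      η z                    ∎
      where open ≡-Reasoning
    vars : ∀ z {y} → y ∈V (F₁.ρ z ⟨ F₂.ρ ⟩) → y ≡ z ⊎ y ∈E E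
    vars z y∈ with ∈V-⟨⟩⁻ (F₁.ρ z) F₂.ρ y∈
    ... | w , w∈ , y∈ρ₂w with F₂.ρ-vars w y∈ρ₂w | F₁.ρ-vars z w∈
    ... | inj₂ y∈E' | _ = inj₂ (⟶-vars s y∈E')
    ... | inj₁ refl | inj₁ refl = inj₁ refl
    ... | inj₁ refl | inj₂ y∈E = inj₂ y∈E

  -- Reordering an equation set

  ↭-split : ∀ {E E₂} L (e : Eqn) R → E ↭ E₂ → E ≡ L ++ e ∷ R →
            ∃₂ λ L₂ R₂ → (E₂ ≡ L₂ ++ e ∷ R₂) × (L ++ R ↭ L₂ ++ R₂)
  ↭-split L e R p refl with ∈-∃++ (↭.∈-resp-↭ p (Any.++⁺ʳ L (here refl)))
  ... | L₂ , R₂ , refl = L₂ , R₂ , refl , ↭.drop-mid L L₂ p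

  ↭-insert : ∀ L (M : EqSet) R L₂ R₂ → L ++ R ↭ L₂ ++ R₂ → L ++ M ++ R ↭ L₂ ++ M ++ R₂
  ↭-insert L M R L₂ R₂ p =
    ↭-trans (↭.shifts L M) (↭-trans (↭.++⁺ˡ M p) (↭-sym (↭.shifts L₂ M)))

  ⟶-↭ : ∀ {E E₂ E'} → E ↭ E₂ → E ⟶ E' → ∃ λ E₂' → E₂ ⟶ E₂' × E' ↭ E₂'
  ⟶-↭ p (act1 L R f ss ts |ss|≡|ts|) with ↭-split L _ R p refl
  ... | L₂ , R₂ , refl , q =
    _ , act1 L₂ R₂ f ss ts |ss|≡|ts| , ↭-insert L (ss ≐̈ ts) R L₂ R₂ q
  ⟶-↭ p (act3 L R x) with ↭-split L _ R p refl
  ... | L₂ , R₂ , refl , q = _ , act3 L₂ R₂ x , q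
  ⟶-↭ p (act4 L R t x t≢var) with ↭-split L _ R p refl
  ... | L₂ , R₂ , refl , q = _ , act4 L₂ R₂ t x t≢var , ↭-insert L [ _ ] R L₂ R₂ q
  ⟶-↭ p (act5 L R x t x∉t x∈LR) with ↭-split L _ R p refl
  ... | L₂ , R₂ , refl , q =
    _ , act5 L₂ R₂ x t x∉t (↭.Any-resp-↭ q x∈LR) ,
    ↭-insert (L ⟨ [ x / t ] ⟩E) [ _ ] (R ⟨ [ x / t ] ⟩E)
             (L₂ ⟨ [ x / t ] ⟩E) (R₂ ⟨ [ x / t ] ⟩E)
      (subst₂ _↭_ (⟨⟩E-++ L R [ x / t ]) (⟨⟩E-++ L₂ R₂ [ x / t ]) (↭.map⁺ _ q))

  Run-↭ : ∀ {E E₂ E'} → E ↭ E₂ → Run E E' → ∃ λ E₂' → Run E₂ E₂' × E' ↭ E₂'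
  Run-↭ p ε = _ , ε , p
  Run-↭ p (s ◅ r) with ⟶-↭ p s
  ... | _ , s₂ , q with Run-↭ q r
  ... | _ , r₂ , q' = _ , s₂ ◅ r₂ , q'

  Act2-↭ : ∀ {E E₂} → E ↭ E₂ → Act2 E → Act2 E₂
  Act2-↭ p (L , R , f , g , ss , ts , E≡ , clash) with ↭-split L _ R p E≡
  ... | L₂ , R₂ , E₂≡ , _ = L₂ , R₂ , f , g , ss , ts , E₂≡ , clash

  Act2-++ : ∀ {E} B → Act2 E → Act2 (E ++ B)
  Act2-++ B (L , R , f , g , ss , ts , refl , clash) =
    L , R ++ B , f , g , ss , ts , ++-assoc-mid L [ _ ] R B , clash

  -- Solved forms

  Solved : EqSet → Set
  Solved E = ∀ L e R → E ≡ L ++ e ∷ R →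
             ∃₂ λ x t → e ≡ (var x ≐ t) × ¬ x ∈V t × ¬ x ∈E (L ++ R)

  Solved⇒Halted : ∀ {E} → Solved E → Halted E
  Solved⇒Halted {E} sol = no-step , no-clash , no-occurs
    where
    no-step : ∀ E' → ¬ E ⟶ E'
    no-step _ (act1 L R f ss ts _) with sol L _ R refl
    ... | _ , _ , () , _
    no-step _ (act3 L R x) with sol L _ R refl
    ... | _ , _ , refl , x∉x , _ = x∉x here
    no-step _ (act4 L R t x t≢var) with sol L _ R refl
    ... | y , _ , refl , _ = t≢var (isVar y)
    no-step _ (act5 L R x t _ x∈LR) with sol L _ R refl
    ... | _ , _ , refl , _ , x∉LR = x∉LR x∈LR
    no-clash : ¬ Act2 E
    no-clash (L , R , f , g , ss , ts , E≡ , _) with sol L _ R E≡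
    ... | _ , _ , () , _
    no-occurs : ¬ Act6 E
    no-occurs (L , R , x , t , E≡ , x∈t , _) with sol L _ R E≡
    ... | _ , _ , refl , x∉t , _ = x∉t x∈t

  Halted⇒Solved : ∀ {E} → Halted E → Solved E
  Halted⇒Solved (no-step , no-clash , no-occurs) L (var x ≐ r) R refl with x ∈V? r
  ... | no x∉r with x ∈E? (L ++ R)
  ...   | yes x∈LR = ⊥-elim (no-step _ (act5 L R x r x∉r x∈LR))
  ...   | no x∉LR = x , r , refl , x∉r , x∉LR
  Halted⇒Solved (no-step , no-clash , no-occurs) L (var x ≐ var y) R refl | yes x∈y with x ≟ y
  ... | yes refl = ⊥-elim (no-step _ (act3 L R x))
  ... | no x≢y =
    ⊥-elim (no-occurs (L , R , x , var y , refl , x∈y , λ y≡x → x≢y (sym (var-injective y≡x))))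
  Halted⇒Solved (no-step , no-clash , no-occurs) L (var x ≐ fun g ts) R refl | yes x∈t =
    ⊥-elim (no-occurs (L , R , x , fun g ts , refl , x∈t , λ ()))
  Halted⇒Solved (no-step , no-clash , no-occurs) L (fun f ss ≐ var x) R refl =
    ⊥-elim (no-step _ (act4 L R (fun f ss) x λ ()))
  Halted⇒Solved (no-step , no-clash , no-occurs) L (fun f ss ≐ fun g ts) R refl
    with length ss ≟ℕ length ts
  ... | no |ss|≢|ts| = ⊥-elim (no-clash (L , R , f , g , ss , ts , refl , inj₂ |ss|≢|ts|))
  ... | yes |ss|≡|ts| = ⊥-elim (no-clash (L , R , f , g , ss , ts , refl ,
                          inj₁ λ { refl → no-step _ (act1 L R f ss ts |ss|≡|ts|) }))

  Solved-↭ : ∀ {E E₂} → E ↭ E₂ → Solved E → Solved E₂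
  Solved-↭ p sol L₂ e R₂ E₂≡ with ↭-split L₂ e R₂ (↭-sym p) E₂≡
  ... | L , R , E≡ , q with sol L e R E≡
  ... | x , t , e≡ , x∉t , x∉LR = x , t , e≡ , x∉t , λ x∈ → x∉LR (↭.Any-resp-↭ q x∈)

  Halted-↭ : ∀ {E E₂} → E ↭ E₂ → Halted E → Halted E₂
  Halted-↭ p halted = Solved⇒Halted (Solved-↭ p (Halted⇒Solved halted))

  Solved-tail : ∀ {e E} → Solved (e ∷ E) → Solved E
  Solved-tail sol L e R refl with sol (_ ∷ L) e R refl
  ... | x , t , e≡ , x∉t , x∉LR = x , t , e≡ , x∉t , λ x∈ → x∉LR (there x∈)

  Solved-head : ∀ {l r E} → Solved ((l ≐ r) ∷ E) → ∃ λ x → l ≡ var x × ¬ x ∈V r × ¬ x ∈E E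
  Solved-head {E = E} sol with sol [] _ E refl
  ... | x , t , refl , x∉t , x∉E = x , refl , x∉t , x∉E

  _∈dom_ : V → EqSet → Set
  x ∈dom E = Any (λ e → lhs e ≡ var x) E

  ∈dom⇒∈E : ∀ {x E} → x ∈dom E → x ∈E E
  ∈dom⇒∈E (here refl) = here (inj₁ here)
  ∈dom⇒∈E (there x∈) = there (∈dom⇒∈E x∈)

  Any-∃++ : ∀ {P : Eqn → Set} {E} → Any P E → ∃₂ λ L R → ∃ λ e → E ≡ L ++ e ∷ R × P e
  Any-∃++ p with find p
  ... | e , e∈E , pe with ∈-∃++ e∈E
  ... | L , R , refl = L , R , e , refl , pe

  Solved-∉rhs : ∀ {l r E} → Solved ((l ≐ r) ∷ E) → ∀ {y} → y ∈dom E → ¬ y ∈V r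
  Solved-∉rhs sol y∈dom y∈r with Any-∃++ y∈dom
  ... | L , R , _ , refl , lhs≡y with sol (_ ∷ L) _ R refl
  ... | _ , _ , refl , _ , x∉ with lhs≡y
  ... | refl = x∉ (here (inj₂ y∈r))

  -- The substitution {x₁/t₁} ⋯ {xₙ/tₙ} of a solved form; equations with a
  -- non-variable left-hand side (never present in a solved form) are skipped.
  substOf : EqSet → Subst
  substOf [] = var
  substOf ((var x ≐ t) ∷ E) = [ x / t ] ⨾ substOf E
  substOf ((fun _ _ ≐ _) ∷ E) = substOf E

  substOf-∉dom : ∀ E z → ¬ z ∈dom E → substOf E z ≡ var z
  substOf-∉dom [] z _ = refl
  substOf-∉dom ((var x ≐ t) ∷ E) z z∉ rewrite [/]-there x t z (λ { refl → z∉ (here refl) }) =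
    substOf-∉dom E z (λ z∈ → z∉ (there z∈))
  substOf-∉dom ((fun _ _ ≐ _) ∷ E) z z∉ = substOf-∉dom E z (λ z∈ → z∉ (there z∈))

  ∈V-substOf : ∀ E z {y} → y ∈V substOf E z → y ≡ z ⊎ y ∈E E
  ∈V-substOf [] z here = inj₁ refl
  ∈V-substOf ((var x ≐ t) ∷ E) z y∈ with ∈V-⟨⟩⁻ ([ x / t ] z) (substOf E) y∈
  ... | w , w∈ , y∈σw with ∈V-substOf E w y∈σw | ∈V-[/]⁻ x t z w∈
  ... | inj₂ y∈E | _ = inj₂ (there y∈E)
  ... | inj₁ refl | inj₁ (_ , y∈t) = inj₂ (here (inj₂ y∈t))
  ... | inj₁ refl | inj₂ (refl , _) = inj₁ refl
  ∈V-substOf ((fun _ _ ≐ _) ∷ E) z y∈ = Sum.map₂ there (∈V-substOf E z y∈)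

  substOf-range-∉dom : ∀ E → Solved E → ∀ w {y} → y ∈V substOf E w → ¬ y ∈dom E
  substOf-range-∉dom [] _ _ _ ()
  substOf-range-∉dom ((fun _ _ ≐ _) ∷ E) sol with Solved-head sol
  ... | _ , () , _
  substOf-range-∉dom ((var x ≐ t) ∷ E) sol w y∈ with Solved-head sol
  ... | _ , refl , x∉t , x∉E with ∈V-⟨⟩⁻ ([ x / t ] w) (substOf E) y∈
  ... | v , v∈ , y∈σv = λ
    { (here refl) → x-eliminated v∈ y∈σv
    ; (there y∈dom) → substOf-range-∉dom E (Solved-tail sol) v y∈σv y∈dom
    }
    where
    x-eliminated : ∀ {v} → v ∈V [ x / t ] w → ¬ x ∈V substOf E v
    x-eliminated v∈ x∈ with ∈V-substOf E _ x∈
    ... | inj₂ x∈E = x∉E x∈E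
    ... | inj₁ refl with ∈V-[/]⁻ x t w v∈
    ...   | inj₁ (_ , x∈t) = x∉t x∈t
    ...   | inj₂ (refl , x≢x) = x≢x refl

  substOf-unifies : ∀ E → Solved E → Unifier (substOf E) E
  substOf-unifies [] _ = []
  substOf-unifies ((fun _ _ ≐ _) ∷ E) sol with Solved-head sol
  ... | _ , () , _
  substOf-unifies ((var x ≐ t) ∷ E) sol with Solved-head sol
  ... | _ , refl , x∉t , x∉E = head ∷ Unifier-⟨⟩⁻ E [ x / t ] σ tail
    where
    σ = substOf E
    head : [ x / t ] x ⟨ σ ⟩ ≡ t ⟨ [ x / t ] ⨾ σ ⟩
    head = begin
      [ x / t ] x ⟨ σ ⟩        ≡⟨ cong (_⟨ σ ⟩) ([/]-here x t) ⟩
      t ⟨ σ ⟩                  ≡⟨ cong (_⟨ σ ⟩) (sym (⟨⟩-[/]-∉ t x t x∉t)) ⟩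
      t ⟨ [ x / t ] ⟩ ⟨ σ ⟩    ≡⟨ ⟨⟩-⨾ t [ x / t ] σ ⟩
      t ⟨ [ x / t ] ⨾ σ ⟩      ∎
      where open ≡-Reasoning
    tail : Unifier σ (E ⟨ [ x / t ] ⟩E)
    tail = subst (Unifier σ) (sym (⟨⟩E-[/]-∉ E x t x∉E)) (substOf-unifies E (Solved-tail sol))

  substOf-absorbed : ∀ E η → Unifier η E → ∀ z → substOf E z ⟨ η ⟩ ≡ η z
  substOf-absorbed [] η _ z = refl
  substOf-absorbed ((var x ≐ t) ∷ E) η (uₑ ∷ u) z = begin
    [ x / t ] z ⟨ substOf E ⟩ ⟨ η ⟩  ≡⟨ ⟨⟩-⨾ ([ x / t ] z) (substOf E) η ⟩
    [ x / t ] z ⟨ substOf E ⨾ η ⟩    ≡⟨ ⟨⟩-cong′ ([ x / t ] z) (substOf-absorbed E η u) ⟩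
    [ x / t ] z ⟨ η ⟩                ≡⟨ [/]⨾-absorbed uₑ z ⟩
    η z                              ∎
    where open ≡-Reasoning
  substOf-absorbed ((fun _ _ ≐ _) ∷ E) η (_ ∷ u) z = substOf-absorbed E η u z

  eliminate : ∀ L R x t → ¬ x ∈V t →
              Run (L ++ (var x ≐ t) ∷ R) (L ⟨ [ x / t ] ⟩E ++ (var x ≐ t) ∷ R ⟨ [ x / t ] ⟩E)
  eliminate L R x t x∉t with x ∈E? (L ++ R)
  ... | yes x∈LR = act5 L R x t x∉t x∈LR ◅ ε
  ... | no x∉LR = subst₂ (λ L' R' → Run (L ++ e ∷ R) (L' ++ e ∷ R'))
                    (sym (⟨⟩E-[/]-∉ L x t (λ x∈L → x∉LR (Any.++⁺ˡ x∈L))))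
                    (sym (⟨⟩E-[/]-∉ R x t (λ x∈R → x∉LR (Any.++⁺ʳ L x∈R)))) ε
    where e = var x ≐ t

  propagate : ∀ S → Solved S → ∀ L R →
              Run (L ++ S ++ R) (L ⟨ substOf S ⟩E ++ S ++ R ⟨ substOf S ⟩E)
  propagate [] _ L R =
    subst₂ (λ L' R' → Run (L ++ R) (L' ++ R')) (sym (⟨⟩E-identity L)) (sym (⟨⟩E-identity R)) ε
  propagate ((fun _ _ ≐ _) ∷ S) sol L R with Solved-head sol
  ... | _ , () , _
  propagate ((var x ≐ t) ∷ S) sol L R with Solved-head sol
  ... | _ , refl , x∉t , x∉S =
    first ◅◅ subst₂ Run (++-assoc L' [ e ] (S ++ R')) target
               (propagate S (Solved-tail sol) (L' ++ [ e ]) R')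
    where
    e = var x ≐ t
    σ = substOf S
    L' = L ⟨ [ x / t ] ⟩E
    R' = R ⟨ [ x / t ] ⟩E
    first : Run (L ++ e ∷ S ++ R) (L' ++ e ∷ S ++ R')
    first = subst (λ Z → Run (L ++ e ∷ S ++ R) (L' ++ e ∷ Z))
              (trans (⟨⟩E-++ S R [ x / t ]) (cong (_++ R') (⟨⟩E-[/]-∉ S x t x∉S)))
              (eliminate L (S ++ R) x t x∉t)
    e-fixed : e ⟨ σ ⟩e ≡ e
    e-fixed = cong₂ _≐_ (substOf-∉dom S x (λ x∈ → x∉S (∈dom⇒∈E x∈)))
      (trans (⟨⟩-cong t (λ y y∈t → substOf-∉dom S y (λ y∈ → Solved-∉rhs sol y∈ y∈t)))
             (⟨⟩-identity t))
    target : (L' ++ [ e ]) ⟨ σ ⟩E ++ S ++ R' ⟨ σ ⟩E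
           ≡ L ⟨ [ x / t ] ⨾ σ ⟩E ++ e ∷ S ++ R ⟨ [ x / t ] ⨾ σ ⟩E
    target = begin
      (L' ++ [ e ]) ⟨ σ ⟩E ++ S ++ R' ⟨ σ ⟩E
        ≡⟨ cong (_++ S ++ R' ⟨ σ ⟩E) (⟨⟩E-++ L' [ e ] σ) ⟩
      (L' ⟨ σ ⟩E ++ [ e ⟨ σ ⟩e ]) ++ S ++ R' ⟨ σ ⟩E
        ≡⟨ ++-assoc (L' ⟨ σ ⟩E) _ _ ⟩
      L' ⟨ σ ⟩E ++ e ⟨ σ ⟩e ∷ S ++ R' ⟨ σ ⟩E
        ≡⟨ cong₂ (λ A e' → A ++ e' ∷ S ++ R' ⟨ σ ⟩E) (⟨⟩E-⨾ L [ x / t ] σ) e-fixed ⟩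
      L ⟨ [ x / t ] ⨾ σ ⟩E ++ e ∷ S ++ R' ⟨ σ ⟩E
        ≡⟨ cong (λ B → L ⟨ [ x / t ] ⨾ σ ⟩E ++ e ∷ S ++ B) (⟨⟩E-⨾ R [ x / t ] σ) ⟩
      L ⟨ [ x / t ] ⨾ σ ⟩E ++ e ∷ S ++ R ⟨ [ x / t ] ⨾ σ ⟩E
        ∎
      where open ≡-Reasoning

  ++-≡-++-∷ : ∀ {A : Set} (xs ys L : List A) {e} R → xs ++ ys ≡ L ++ e ∷ R →
              (∃ λ xs₂ → xs ≡ L ++ e ∷ xs₂ × R ≡ xs₂ ++ ys) ⊎
              (∃ λ ys₁ → L ≡ xs ++ ys₁ × ys ≡ ys₁ ++ e ∷ R)
  ++-≡-++-∷ [] ys L R eq = inj₂ (L , refl , eq)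
  ++-≡-++-∷ (x ∷ xs) ys [] R eq with ∷-injective eq
  ... | refl , refl = inj₁ (xs , refl , refl)
  ++-≡-++-∷ (x ∷ xs) ys (l ∷ L) R eq with ∷-injective eq
  ... | refl , eq′ with ++-≡-++-∷ xs ys L R eq′
  ... | inj₁ (xs₂ , refl , refl) = inj₁ (xs₂ , refl , refl)
  ... | inj₂ (ys₁ , refl , refl) = inj₂ (ys₁ , refl , refl)

  map-≡-++-∷ : ∀ {A B : Set} (f : A → B) xs L₂ {y} R₂ → map f xs ≡ L₂ ++ y ∷ R₂ →
    ∃₂ λ L R → ∃ λ x → xs ≡ L ++ x ∷ R × map f L ≡ L₂ × f x ≡ y × map f R ≡ R₂
  map-≡-++-∷ f (x ∷ xs) [] R₂ eq with ∷-injective eq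
  ... | fx≡y , eq′ = [] , xs , x , refl , refl , fx≡y , eq′
  map-≡-++-∷ f (x ∷ xs) (l ∷ L₂) R₂ eq with ∷-injective eq
  ... | refl , eq′ with map-≡-++-∷ f xs L₂ R₂ eq′
  ... | L , R , x′ , refl , refl , fx′≡y , refl = x ∷ L , R , x′ , refl , refl , fx′≡y , refl

  Solved-++ : ∀ {A B} → Solved A → Solved B →
              (∀ x → x ∈dom A → ¬ x ∈E B) → (∀ y → y ∈dom B → ¬ y ∈E A) → Solved (A ++ B)
  Solved-++ {A} {B} solA solB domA∉B domB∉A L e R eq with ++-≡-++-∷ A B L R eq
  ... | inj₁ (A₂ , refl , refl) with solA L e A₂ refl
  ...   | x , t , refl , x∉t , x∉LA₂ = x , t , refl , x∉t , x∉
    where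
    x∉ : ¬ x ∈E (L ++ A₂ ++ B)
    x∉ x∈ with Any.++⁻ L x∈
    ... | inj₁ x∈L = x∉LA₂ (Any.++⁺ˡ x∈L)
    ... | inj₂ x∈A₂B with Any.++⁻ A₂ x∈A₂B
    ...   | inj₁ x∈A₂ = x∉LA₂ (Any.++⁺ʳ L x∈A₂)
    ...   | inj₂ x∈B = domA∉B x (Any.++⁺ʳ L (here refl)) x∈B
  Solved-++ {A} {B} solA solB domA∉B domB∉A L e R eq | inj₂ (B₁ , refl , refl) with solB B₁ e R refl
  ...   | x , t , refl , x∉t , x∉B₁R = x , t , refl , x∉t , x∉
    where
    x∉ : ¬ x ∈E ((A ++ B₁) ++ R)
    x∉ x∈ with Any.++⁻ (A ++ B₁) x∈
    ... | inj₂ x∈R = x∉B₁R (Any.++⁺ʳ B₁ x∈R)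
    ... | inj₁ x∈AB₁ with Any.++⁻ A x∈AB₁
    ...   | inj₁ x∈A = domB∉A x (Any.++⁺ʳ B₁ (here refl)) x∈A
    ...   | inj₂ x∈B₁ = x∉B₁R (Any.++⁺ˡ x∈B₁)

  RenamesDom : Subst → EqSet → Set
  RenamesDom τ E = ∀ x → x ∈dom E → ∃ λ x′ → τ x ≡ var x′ × (∀ z → z ∈E E → x′ ∈V τ z → z ≡ x)

  Solved-⟨⟩ : ∀ {E} τ → Solved E → RenamesDom τ E → Solved (E ⟨ τ ⟩E)
  Solved-⟨⟩ {E} τ sol τ-renames L₂ e₂ R₂ eq with map-≡-++-∷ _ E L₂ R₂ eq
  ... | L , R , e , refl , refl , refl , refl with sol L e R refl
  ... | x , t , refl , x∉t , x∉LR with τ-renames x (Any.++⁺ʳ L (here refl))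
  ... | x′ , τx≡x′ , x′-only-in-τx =
    x′ , t ⟨ τ ⟩ , cong (_≐ (t ⟨ τ ⟩)) τx≡x′ , x′∉tτ , x′∉LRτ
    where
    x′∉tτ : ¬ x′ ∈V (t ⟨ τ ⟩)
    x′∉tτ x′∈ with ∈V-⟨⟩⁻ t τ x′∈
    ... | z , z∈t , x′∈τz with x′-only-in-τx z (Any.++⁺ʳ L (here (inj₂ z∈t))) x′∈τz
    ... | refl = x∉t z∈t
    x′∉LRτ : ¬ x′ ∈E (L ⟨ τ ⟩E ++ R ⟨ τ ⟩E)
    x′∉LRτ x′∈ with ∈E-⟨⟩⁻ (L ++ R) τ (subst (x′ ∈E_) (sym (⟨⟩E-++ L R τ)) x′∈)
    ... | z , z∈LR , x′∈τz with Any.++⁻ L z∈LR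
    ... | inj₁ z∈L with x′-only-in-τx z (Any.++⁺ˡ z∈L) x′∈τz
    ...   | refl = x∉LR z∈LR
    x′∉LRτ x′∈ | z , z∈LR , x′∈τz | inj₂ z∈R
      with x′-only-in-τx z (Any.++⁺ʳ L (there z∈R)) x′∈τz
    ...   | refl = x∉LR z∈LR

  ∈dom-⟨⟩ : ∀ {E x} τ → Solved E → x ∈dom (E ⟨ τ ⟩E) → ∃ λ z → z ∈dom E × τ z ≡ var x
  ∈dom-⟨⟩ τ sol x∈dom with Any-∃++ (Any.map⁻ x∈dom)
  ... | L , R , e , refl , τ-lhs with sol L e R refl
  ... | z , _ , refl , _ = z , Any.++⁺ʳ L (here refl) , τ-lhs

  -- Renamings

  InverseOn : Subst → Subst → EqSet → Set
  InverseOn τ δ E = ∀ y → y ∈E E → δ y ⟨ τ ⟩ ≡ var y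

  Act2-⟨⟩ : ∀ {E} δ → Act2 E → Act2 (E ⟨ δ ⟩E)
  Act2-⟨⟩ δ (L , R , f , g , ss , ts , refl , clash) =
    L ⟨ δ ⟩E , R ⟨ δ ⟩E , f , g , ss ⟨ δ ⟩s , ts ⟨ δ ⟩s , ⟨⟩E-++ L _ δ ,
    Sum.map₂ (λ |ss|≢|ts| eq →
                |ss|≢|ts| (trans (sym (length-⟨⟩s ss δ)) (trans eq (length-⟨⟩s ts δ)))) clash

  module Renaming {τ δ E} (inv : InverseOn τ δ E) where

    δ-var : ∀ {y} → y ∈E E → ∃ λ y′ → δ y ≡ var y′
    δ-var {y} y∈ with δ y | inv y y∈
    ... | var y′ | _ = y′ , refl
    ... | fun _ _ | ()

    δ-injective : ∀ {y z} → y ∈E E → z ∈E E → δ y ≡ δ z → y ≡ z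
    δ-injective {y} {z} y∈ z∈ δy≡δz =
      var-injective (trans (sym (inv y y∈)) (trans (cong (_⟨ τ ⟩) δy≡δz) (inv z z∈)))

    δ-[/] : ∀ x t {x′} → δ x ≡ var x′ → x ∈E E → ∀ y → y ∈E E →
            δ y ⟨ [ x′ / t ⟨ δ ⟩ ] ⟩ ≡ [ x / t ] y ⟨ δ ⟩
    δ-[/] x t {x′} δx≡x′ x∈ y y∈ with y ≟ x
    ... | yes refl = trans (cong (_⟨ [ x′ / t ⟨ δ ⟩ ] ⟩) δx≡x′) ([/]-here x′ _)
    ... | no y≢x with δ-var y∈
    ...   | y′ , δy≡y′ = begin
      δ y ⟨ [ x′ / t ⟨ δ ⟩ ] ⟩  ≡⟨ cong (_⟨ [ x′ / t ⟨ δ ⟩ ] ⟩) δy≡y′ ⟩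
      [ x′ / t ⟨ δ ⟩ ] y′      ≡⟨ [/]-there x′ _ y′ y′≢x′ ⟩
      var y′                   ≡⟨ sym δy≡y′ ⟩
      δ y                      ∎
      where
      open ≡-Reasoning
      y′≢x′ : y′ ≢ x′
      y′≢x′ refl = y≢x (δ-injective y∈ x∈ (trans δy≡y′ (sym δx≡x′)))

    ⟨⟩E-δ-[/] : ∀ x t {x′} → δ x ≡ var x′ → x ∈E E → ∀ M → (∀ y → y ∈E M → y ∈E E) →
                M ⟨ δ ⟩E ⟨ [ x′ / t ⟨ δ ⟩ ] ⟩E ≡ M ⟨ [ x / t ] ⟩E ⟨ δ ⟩E
    ⟨⟩E-δ-[/] x t δx≡x′ x∈ M M⊆E =
      trans (⟨⟩E-⨾ M δ _)
        (trans (⟨⟩E-cong M (λ y y∈ → δ-[/] x t δx≡x′ x∈ y (M⊆E y y∈)))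
               (sym (⟨⟩E-⨾ M [ x / t ] δ)))

    ⟨⟩E-++-∷ : ∀ L {e e′} R → e ⟨ δ ⟩e ≡ e′ → (L ++ e ∷ R) ⟨ δ ⟩E ≡ L ⟨ δ ⟩E ++ e′ ∷ R ⟨ δ ⟩E
    ⟨⟩E-++-∷ L R eδ≡e′ =
      trans (⟨⟩E-++ L (_ ∷ R) δ) (cong (λ e′ → L ⟨ δ ⟩E ++ e′ ∷ R ⟨ δ ⟩E) eδ≡e′)

    ⟶-rename : ∀ {E'} → E ⟶ E' → (E ⟨ δ ⟩E) ⟶ (E' ⟨ δ ⟩E)
    ⟶-rename (act1 L R f ss ts |ss|≡|ts|) =
      subst₂ _⟶_ (sym (⟨⟩E-++-∷ L R refl)) (sym target)
        (act1 (L ⟨ δ ⟩E) (R ⟨ δ ⟩E) f (ss ⟨ δ ⟩s) (ts ⟨ δ ⟩s)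
          (trans (length-⟨⟩s ss δ) (trans |ss|≡|ts| (sym (length-⟨⟩s ts δ)))))
      where
      target : (L ++ (ss ≐̈ ts) ++ R) ⟨ δ ⟩E
             ≡ L ⟨ δ ⟩E ++ ((ss ⟨ δ ⟩s) ≐̈ (ts ⟨ δ ⟩s)) ++ R ⟨ δ ⟩E
      target = trans (⟨⟩E-++ L _ δ)
        (cong (L ⟨ δ ⟩E ++_)
          (trans (⟨⟩E-++ (ss ≐̈ ts) R δ) (cong (_++ R ⟨ δ ⟩E) (≐̈-⟨⟩ ss ts δ))))
    ⟶-rename (act3 L R x) with δ-var (Any.++⁺ʳ L (here (inj₁ here)))
    ... | x′ , δx≡x′ =
      subst₂ _⟶_
        (sym (⟨⟩E-++-∷ L R (cong (λ u → u ≐ u) δx≡x′)))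
        (sym (⟨⟩E-++ L R δ))
        (act3 (L ⟨ δ ⟩E) (R ⟨ δ ⟩E) x′)
    ⟶-rename (act4 L R (var y) x t≢var) = ⊥-elim (t≢var (isVar y))
    ⟶-rename (act4 L R (fun f ts) x _) with δ-var (Any.++⁺ʳ L (here (inj₂ here)))
    ... | x′ , δx≡x′ =
      subst₂ _⟶_
        (sym (⟨⟩E-++-∷ L R (cong (fun f (ts ⟨ δ ⟩s) ≐_) δx≡x′)))
        (sym (⟨⟩E-++-∷ L R (cong (_≐ fun f (ts ⟨ δ ⟩s)) δx≡x′)))
        (act4 (L ⟨ δ ⟩E) (R ⟨ δ ⟩E) (fun f (ts ⟨ δ ⟩s)) x′ λ ())
    ⟶-rename (act5 L R x t x∉t x∈LR) with δ-var x∈E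
      where x∈E = Any.++⁺ʳ L (here (inj₁ here))
    ... | x′ , δx≡x′ =
      subst₂ _⟶_
        (sym (⟨⟩E-++-∷ L R (cong (_≐ (t ⟨ δ ⟩)) δx≡x′)))
        target
        (act5 (L ⟨ δ ⟩E) (R ⟨ δ ⟩E) x′ (t ⟨ δ ⟩) x′∉tδ x′∈LRδ)
      where
      x∈E : x ∈E E
      x∈E = Any.++⁺ʳ L (here (inj₁ here))
      [x′/tδ] = [ x′ / t ⟨ δ ⟩ ]
      target : L ⟨ δ ⟩E ⟨ [x′/tδ] ⟩E ++ (var x′ ≐ (t ⟨ δ ⟩)) ∷ R ⟨ δ ⟩E ⟨ [x′/tδ] ⟩E
             ≡ (L ⟨ [ x / t ] ⟩E ++ (var x ≐ t) ∷ R ⟨ [ x / t ] ⟩E) ⟨ δ ⟩E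
      target = begin
        L ⟨ δ ⟩E ⟨ [x′/tδ] ⟩E ++ (var x′ ≐ (t ⟨ δ ⟩)) ∷ R ⟨ δ ⟩E ⟨ [x′/tδ] ⟩E
          ≡⟨ cong₂ (λ A B → A ++ (var x′ ≐ (t ⟨ δ ⟩)) ∷ B)
               (⟨⟩E-δ-[/] x t δx≡x′ x∈E L (λ _ y∈L → Any.++⁺ˡ y∈L))
               (⟨⟩E-δ-[/] x t δx≡x′ x∈E R (λ _ y∈R → Any.++⁺ʳ L (there y∈R))) ⟩
        L ⟨ [ x / t ] ⟩E ⟨ δ ⟩E ++ (var x′ ≐ (t ⟨ δ ⟩)) ∷ R ⟨ [ x / t ] ⟩E ⟨ δ ⟩E
          ≡⟨ sym (⟨⟩E-++-∷ (L ⟨ [ x / t ] ⟩E) (R ⟨ [ x / t ] ⟩E) (cong (_≐ (t ⟨ δ ⟩)) δx≡x′)) ⟩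
        (L ⟨ [ x / t ] ⟩E ++ (var x ≐ t) ∷ R ⟨ [ x / t ] ⟩E) ⟨ δ ⟩E
          ∎
        where open ≡-Reasoning
      x′∉tδ : ¬ x′ ∈V (t ⟨ δ ⟩)
      x′∉tδ x′∈ with ∈V-⟨⟩⁻ t δ x′∈
      ... | z , z∈t , x′∈δz with δ-var (Any.++⁺ʳ L (here (inj₂ z∈t)))
      ... | z′ , δz≡z′ with subst (x′ ∈V_) δz≡z′ x′∈δz
      ... | here
        with δ-injective (Any.++⁺ʳ L (here (inj₂ z∈t))) x∈E (trans δz≡z′ (sym δx≡x′))
      ... | refl = x∉t z∈t
      x′∈LRδ : x′ ∈E (L ⟨ δ ⟩E ++ R ⟨ δ ⟩E)
      x′∈LRδ = subst (x′ ∈E_) (⟨⟩E-++ L R δ)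
                 (∈E-⟨⟩⁺ (L ++ R) δ x∈LR (subst (x′ ∈V_) (sym δx≡x′) here))

  Run-rename : ∀ {τ δ E E'} → InverseOn τ δ E → Run E E' → Run (E ⟨ δ ⟩E) (E' ⟨ δ ⟩E)
  Run-rename inv ε = ε
  Run-rename {τ} {δ} {E} inv (s ◅ r) =
    Renaming.⟶-rename {τ} {δ} {E} inv s ◅ Run-rename (λ y y∈ → inv y (⟶-vars s y∈)) r

  Solved-rename : ∀ {τ δ E} → InverseOn τ δ E → Solved E → Solved (E ⟨ δ ⟩E)
  Solved-rename {τ} {δ} {E} inv sol = Solved-⟨⟩ δ sol δ-renames
    where
    open Renaming {τ} {δ} {E} inv
    δ-renames : RenamesDom δ E
    δ-renames x x∈dom with δ-var (∈dom⇒∈E x∈dom)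
    ... | x′ , δx≡x′ = x′ , δx≡x′ , only-x
      where
      only-x : ∀ z → z ∈E E → x′ ∈V δ z → z ≡ x
      only-x z z∈ x′∈δz with δ-var z∈
      ... | z′ , δz≡z′ with subst (x′ ∈V_) δz≡z′ x′∈δz
      ... | here = δ-injective z∈ (∈dom⇒∈E x∈dom) (trans δz≡z′ (sym δx≡x′))

  WNSTO-rename : ∀ {τ δ E} → InverseOn τ δ E → WNSTO E → WNSTO (E ⟨ δ ⟩E)
  WNSTO-rename {δ = δ} inv (E' , r , end) =
    E' ⟨ δ ⟩E , Run-rename inv r ,
    Sum.map (Act2-⟨⟩ δ) (λ halted → Solved⇒Halted (Solved-rename inv′ (Halted⇒Solved halted))) end
    where inv′ = λ y y∈ → inv y (Run-vars r y∈)

  WNSTO-◅◅ : ∀ {E E'} → Run E E' → WNSTO E' → WNSTO E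
  WNSTO-◅◅ r (E'' , r' , end) = E'' , r ◅◅ r' , end

  WNSTO-↭ : ∀ {E E₂} → E ↭ E₂ → WNSTO E → WNSTO E₂
  WNSTO-↭ p (E' , r , end) with Run-↭ p r
  ... | E₂' , r₂ , q = E₂' , r₂ , Sum.map (Act2-↭ q) (Halted-↭ q) end

  WNSTO-fun : ∀ f ss ts → length ss ≡ length ts → WNSTO (ss ≐̈ ts) → WNSTOₑ (fun f ss ≐ fun f ts)
  WNSTO-fun f ss ts |ss|≡|ts| = WNSTO-◅◅ (decompose ◅ ε)
    where
    decompose : ((fun f ss ≐ fun f ts) ∷ []) ⟶ (ss ≐̈ ts)
    decompose = subst (_ ⟶_) (++-identityʳ (ss ≐̈ ts)) (act1 [] [] f ss ts |ss|≡|ts|)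

  ≐̈-↭-ins-outs : ∀ ms as as' → length as ≡ length ms → length as' ≡ length ms →
                 (as ≐̈ as') ↭ (ins ms as ≐̈ ins ms as') ++ (outs ms as ≐̈ outs ms as')
  ≐̈-↭-ins-outs [] [] [] _ _ = ↭-refl
  ≐̈-↭-ins-outs [] (_ ∷ _) _ () _
  ≐̈-↭-ins-outs [] [] (_ ∷ _) _ ()
  ≐̈-↭-ins-outs (_ ∷ _) [] _ () _
  ≐̈-↭-ins-outs (_ ∷ _) (_ ∷ _) [] _ ()
  ≐̈-↭-ins-outs (plus ∷ ms) (a ∷ as) (a' ∷ as') |as| |as'| =
    prep (a ≐ a') (≐̈-↭-ins-outs ms as as' (suc-injective |as|) (suc-injective |as'|))
  ≐̈-↭-ins-outs (minus ∷ ms) (a ∷ as) (a' ∷ as') |as| |as'| =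
    ↭-trans (prep (a ≐ a') (≐̈-↭-ins-outs ms as as' (suc-injective |as|) (suc-injective |as'|)))
            (↭-sym (↭.shift (a ≐ a') (ins ms as ≐̈ ins ms as') (outs ms as ≐̈ outs ms as')))

  Run-Halted-Unifiable : ∀ {I S} → Run I S → Halted S → Unifiable I
  Run-Halted-Unifiable {S = S} r halted =
    substOf S , Run-Unifier⁻ r (substOf-unifies S (Halted⇒Solved halted))

  WNSTO-++-Act2 : ∀ {I I*} → Run I I* → Act2 I* → ∀ O → WNSTO (I ++ O)
  WNSTO-++-Act2 r clash O = _ , Framed.run (Run-frame r O) , inj₁ (Act2-++ _ clash)

  Run-++-solved : ∀ {I S} → Run I S → Solved S → ∀ O → Run (I ++ O) (S ++ O ⟨ substOf S ⟩E)
  Run-++-solved {S = S} r solS O =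
    F.run ◅◅ subst (λ O' → Run (S ++ O ⟨ F.ρ ⟩E) (S ++ O')) ρ-absorbed
               (propagate S solS [] (O ⟨ F.ρ ⟩E))
    where
    module F = Framed (Run-frame r O)
    ρ-absorbed : O ⟨ F.ρ ⟩E ⟨ substOf S ⟩E ≡ O ⟨ substOf S ⟩E
    ρ-absorbed = trans (⟨⟩E-⨾ O F.ρ (substOf S))
                       (⟨⟩E-cong O (λ z _ → F.ρ-absorbed (substOf S) (substOf-unifies S solS) z))

  -- As θ is most general, σ = θδ; then θδθ = σθ = θ, so θ undoes δ on the range of θ.
  WNSTO-mgu-instance : ∀ {θ σ I} → MGU θ I → Unifier σ I → (∀ z → σ z ⟨ θ ⟩ ≡ θ z) →
                       ∀ E → WNSTO (E ⟨ θ ⟩E) → WNSTO (E ⟨ σ ⟩E)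
  WNSTO-mgu-instance {θ} {σ} (_ , most-general) uσ θ-absorbs-σ E wEθ =
    subst WNSTO Eθδ≡Eσ (WNSTO-rename inverse wEθ)
    where
    δ = proj₁ (most-general σ uσ)
    σ≡θδ : ∀ x → σ x ≡ θ x ⟨ δ ⟩
    σ≡θδ = proj₂ (most-general σ uσ)
    θ-fixed : ∀ z → θ z ⟨ δ ⨾ θ ⟩ ≡ θ z
    θ-fixed z = begin
      θ z ⟨ δ ⨾ θ ⟩      ≡⟨ sym (⟨⟩-⨾ (θ z) δ θ) ⟩
      θ z ⟨ δ ⟩ ⟨ θ ⟩    ≡⟨ cong (_⟨ θ ⟩) (sym (σ≡θδ z)) ⟩
      σ z ⟨ θ ⟩          ≡⟨ θ-absorbs-σ z ⟩
      θ z                ∎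
      where open ≡-Reasoning
    inverse : InverseOn θ δ (E ⟨ θ ⟩E)
    inverse y y∈ with ∈E-⟨⟩⁻ E θ y∈
    ... | z , _ , y∈θz = ⟨⟩-fixed (θ z) (δ ⨾ θ) (θ-fixed z) y∈θz
    Eθδ≡Eσ : E ⟨ θ ⟩E ⟨ δ ⟩E ≡ E ⟨ σ ⟩E
    Eθδ≡Eσ = trans (⟨⟩E-⨾ E θ δ) (⟨⟩E-cong E (λ z _ → sym (σ≡θδ z)))

  Solved-++-framed : ∀ {S O H} (F : Framed O H S) → Run O H → Solved S → Solved H →
                     (∀ y → y ∈E O → ¬ y ∈dom S) →
                     Solved (H ++ S ⟨ Framed.ρ F ⨾ substOf H ⟩E)
  Solved-++-framed {S} {O} {H} F r solS solH fresh =
    Solved-++ solH (Solved-⟨⟩ τ solS τ-renames) domH∉Sτ domSτ∉H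
    where
    open Framed F
    τ = ρ ⨾ substOf H
    ∉O : ∀ {x} → x ∈dom S → ¬ x ∈E O
    ∉O x∈dom x∈O = fresh _ x∈O x∈dom
    τ-fixes : ∀ x → x ∈dom S → τ x ≡ var x
    τ-fixes x x∈dom = trans (cong (_⟨ substOf H ⟩) (ρ-∉ x (∉O x∈dom)))
      (substOf-∉dom H x (λ x∈domH → ∉O x∈dom (Run-vars r (∈dom⇒∈E x∈domH))))
    τ-only : ∀ x → x ∈dom S → ∀ z → x ∈V τ z → z ≡ x
    τ-only x x∈dom z x∈τz with ∈V-⟨⟩⁻ (ρ z) (substOf H) x∈τz
    ... | w , w∈ρz , x∈σw with ∈V-substOf H w x∈σw
    ... | inj₂ x∈H = ⊥-elim (∉O x∈dom (Run-vars r x∈H))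
    ... | inj₁ refl with ρ-vars z w∈ρz
    ...   | inj₁ x≡z = sym x≡z
    ...   | inj₂ x∈O = ⊥-elim (∉O x∈dom x∈O)
    τ-renames : RenamesDom τ S
    τ-renames x x∈dom = x , τ-fixes x x∈dom , λ z _ → τ-only x x∈dom z
    domH∉Sτ : ∀ y → y ∈dom H → ¬ y ∈E (S ⟨ τ ⟩E)
    domH∉Sτ y y∈dom y∈ with ∈E-⟨⟩⁻ S τ y∈
    ... | z , _ , y∈τz with ∈V-⟨⟩⁻ (ρ z) (substOf H) y∈τz
    ... | w , _ , y∈σw = substOf-range-∉dom H solH w y∈σw y∈dom
    domSτ∉H : ∀ y → y ∈dom (S ⟨ τ ⟩E) → ¬ y ∈E H
    domSτ∉H y y∈dom y∈H with ∈dom-⟨⟩ τ solS y∈dom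
    ... | z , z∈dom , τz≡y with var-injective (trans (sym (τ-fixes z z∈dom)) τz≡y)
    ... | refl = ∉O z∈dom (Run-vars r y∈H)

  WNSTO-solved-++ : ∀ {S O} → Solved S → (∀ y → y ∈E O → ¬ y ∈dom S) → WNSTO O → WNSTO (S ++ O)
  WNSTO-solved-++ {S} {O} solS fresh (H , r , end) =
    WNSTO-↭ (↭.++-comm O S) (WNSTO-◅◅ F.run (continue end))
    where
    module F = Framed (Run-frame r S)
    continue : Act2 H ⊎ Halted H → WNSTO (H ++ S ⟨ F.ρ ⟩E)
    continue (inj₁ clash) = _ , ε , inj₁ (Act2-++ _ clash)
    continue (inj₂ halted) =
      _ , propagate H solH [] (S ⟨ F.ρ ⟩E) ,
      inj₂ (Solved⇒Halted (subst (λ S' → Solved (H ++ S')) (sym (⟨⟩E-⨾ S F.ρ (substOf H)))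
                             (Solved-++-framed (Run-frame r S) r solS solH fresh)))
      where solH = Halted⇒Solved halted

  WNSTO-++-Halted : ∀ {I S θ} → Run I S → Halted S → MGU θ I →
                    ∀ O → WNSTO (O ⟨ θ ⟩E) → WNSTO (I ++ O)
  WNSTO-++-Halted {S = S} {θ} r halted mgu O wOθ =
    WNSTO-◅◅ (Run-++-solved r solS O) (WNSTO-solved-++ solS fresh wOσ)
    where
    solS = Halted⇒Solved halted
    σ = substOf S
    wOσ : WNSTO (O ⟨ σ ⟩E)
    wOσ = WNSTO-mgu-instance mgu (Run-Unifier⁻ r (substOf-unifies S solS))
            (substOf-absorbed S θ (Run-Unifier⁺ r (proj₁ mgu))) O wOθ
    fresh : ∀ y → y ∈E (O ⟨ σ ⟩E) → ¬ y ∈dom S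
    fresh y y∈ with ∈E-⟨⟩⁻ O σ y∈
    ... | z , _ , y∈σz = substOf-range-∉dom S solS z y∈σz

corollary14 : {F V : Set} (_≟_ : DecidableEquality V) →
    let open Syntax F V _≟_ in
    (M : Moding) (p : F) (as as' : List Term) →
    WellModed M p as → WellModed M p as' →
    WNSTO (ins (M p) as ≐̈ ins (M p) as') →
    ((¬ Unifiable (ins (M p) as ≐̈ ins (M p) as') →
        WNSTOₑ (fun p as ≐ fun p as'))
    × (∀ θ → MGU θ (ins (M p) as ≐̈ ins (M p) as') →
        WNSTO ((outs (M p) as ≐̈ outs (M p) as') ⟨ θ ⟩E) →
        WNSTOₑ (fun p as ≐ fun p as')))
corollary14 {F} {V} _≟_ M p as as' wm wm' (I* , r , end) = not-unifiable , via-mgu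
  where
  open MMA F V _≟_
  I = ins (M p) as ≐̈ ins (M p) as'
  O = outs (M p) as ≐̈ outs (M p) as'
  from-ins-outs : WNSTO (I ++ O) → WNSTOₑ (fun p as ≐ fun p as')
  from-ins-outs w = WNSTO-fun p as as' (trans wm (sym wm'))
                      (WNSTO-↭ (↭-sym (≐̈-↭-ins-outs (M p) as as' wm wm')) w)
  after-ins : (Halted I* → WNSTO (I ++ O)) → WNSTOₑ (fun p as ≐ fun p as')
  after-ins halted-case = from-ins-outs ([ (λ clash → WNSTO-++-Act2 r clash O) , halted-case ]′ end)
  not-unifiable : ¬ Unifiable I → WNSTOₑ (fun p as ≐ fun p as')
  not-unifiable ¬unifiable = after-ins (λ halted → ⊥-elim (¬unifiable (Run-Halted-Unifiable r halted)))
  via-mgu : ∀ θ → MGU θ I → WNSTO (O ⟨ θ ⟩E) → WNSTOₑ (fun p as ≐ fun p as')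
  via-mgu θ mgu wOθ = after-ins (λ halted → WNSTO-++-Halted r halted mgu O wOθ)
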